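{- Let $G$ be a graph and, for $i \in \{1,2\}$, let $(R_i, S_i)$ be hedgehogs in $G$ with $R_1 \cap R_2 = \emptyset$. Suppose that $\min\{|S_1|, |S_2|\} \ge 3$ and that there exist two vertex-disjoint edges of $G$ each having one endpoint in $R_1$ and the other in $R_2$. Then $G$ contains cycles of every length between $6$ and $|S_1| + |S_2|$.
   Context: A hedgehog in a graph $G$ is a pair $(W,X)$ with $X \subseteq W \subseteq V(G)$ such that $X$ induces a complete subgraph of $G$ and every vertex of $W \setminus X$ is adjacent to every vertex of $X$. -}

module Defs where

open import Data.Nat using (ℕ; _≤_; _∸_)
open import Data.Fin using (Fin; toℕ)
open import Data.Fin.Subset using (Subset; _∈_; _∉_; _⊆_; _∩_; Empty)
open import Data.Product using (_×_; Σ; ∃; ∃-syntax)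
open import Relation.Nullary using (¬_; Dec)
open import Relation.Binary.PropositionalEquality using (_≡_; _≢_)
open import Function.Definitions using (Injective)
open import Data.Nat using (suc; zero)

record Graph (n : ℕ) : Set₁ where
  field
    Adj     : Fin n → Fin n → Set
    sym     : ∀ {x y} → Adj x y → Adj y x
    irrefl  : ∀ {x} → ¬ Adj x x
    adj?    : ∀ x y → Dec (Adj x y)
open Graph public

record Hedgehog {n : ℕ} (G : Graph n) (W X : Subset n) : Set where
  field
    X⊆W      : X ⊆ W
    clique   : ∀ x y → x ∈ X → y ∈ X → x ≢ y → Adj G x y
    spikes   : ∀ w x → w ∈ W → w ∉ X → x ∈ X → Adj G w x

record Cycle {n : ℕ} (G : Graph n) (k : ℕ) : Set where
  field
    length≥3 : 3 ≤ k
    vertex   : Fin k → Fin n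
    distinct : Injective _≡_ _≡_ vertex
    step     : ∀ (i j : Fin k) → toℕ j ≡ suc (toℕ i) → Adj G (vertex i) (vertex j)
    close    : ∀ (i j : Fin k) → toℕ i ≡ k ∸ 1 → toℕ j ≡ 0 → Adj G (vertex i) (vertex j)

TwoDisjointCrossingEdges : {n : ℕ} → Graph n → Subset n → Subset n → Set
TwoDisjointCrossingEdges G A B =
  ∃[ a₁ ] ∃[ b₁ ] ∃[ a₂ ] ∃[ b₂ ]
    (a₁ ∈ A × b₁ ∈ B × a₂ ∈ A × b₂ ∈ B ×
     Adj G a₁ b₁ × Adj G a₂ b₂ ×
     a₁ ≢ a₂ × a₁ ≢ b₂ × b₁ ≢ a₂ × b₁ ≢ b₂)

-- Inside a hedgehog (R, S), any two distinct vertices of R are joined by a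
-- path whose inner vertices are any m ≥ 1 further vertices of S (at least one,
-- since the ends need not be adjacent): S is a clique, and every vertex of R
-- is adjacent to every other vertex of S.
-- Such a path a₁ ⋯ a₂ in R₁ and such a path b₂ ⋯ b₁ in R₂ are disjoint, and
-- the two crossing edges a₂b₂ and b₁a₁ close them into a cycle. The path in
-- Rᵢ can have any number of vertices between 3 and |Sᵢ|, so the cycle can
-- have any length between 6 and |S₁| + |S₂|.
module Submission where

open import Defs
open import Data.Nat using (ℕ; _≤_; _+_)
open import Data.Fin.Subset using (Subset; _∩_; Empty; ∣_∣)

open import Data.Nat.Base using (suc; z≤n; s≤s; s≤s⁻¹; _∸_)
open import Data.Nat.Properties
  using (≤-trans; ≤-reflexive; ≰⇒>; <⇒≤; +-comm; m≤m+n; m≤n+m; _≤?_;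
         m≤n⇒m⊓n≡m; m∸n+n≡m; m+[n∸m]≡n; m≤n+o⇒m∸n≤o; m+n≤o⇒m≤o∸n)
import Data.Nat.Properties as ℕ
open import Data.Fin.Base using (Fin; toℕ)
import Data.Fin.Base as Fin
open import Data.Fin.Properties using (_≟_)
import Data.Fin.Properties as Fin
open import Data.Fin.Subset using (inside; outside; _∈_)
open import Data.Fin.Subset.Properties using (_∈?_; x∈p∩q⁺)
open import Data.Vec.Base using ([]; _∷_; here; there)
open import Data.Maybe.Base using (just)
open import Data.Maybe.Properties using (just-injective)
open import Data.Maybe.Relation.Binary.Connected using (Connected; just)
open import Data.List.Base
  using (List; []; _∷_; _++_; [_]; length; map; filter; take; lookup; head; last)
open import Data.List.Properties using (length-map; length-++; length-take; filter-all)
open import Data.List.Membership.Propositional.Properties using (∈-lookup)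
open import Data.List.Relation.Unary.All using (All; []; _∷_)
import Data.List.Relation.Unary.All as All
import Data.List.Relation.Unary.All.Properties as All
open import Data.List.Relation.Unary.AllPairs using ([]; _∷_)
open import Data.List.Relation.Unary.Unique.Propositional using (Unique)
import Data.List.Relation.Unary.Unique.Propositional.Properties as Unique
open import Data.List.Relation.Unary.Linked using (Linked; []; [-]; _∷_)
import Data.List.Relation.Unary.Linked.Properties as Linked
open import Data.List.Relation.Unary.Any using (here)
open import Data.List.Relation.Binary.Disjoint.Propositional using (Disjoint)
open import Data.Product using (Σ; _×_; _,_; ∃-syntax)
open import Function.Base using (_∘_)
open import Function.Definitions using (Injective)
open import Relation.Nullary using (yes; no; ¬?)
open import Relation.Binary.PropositionalEquality as ≡
  using (_≡_; refl; cong; subst; subst₂; _≢_; ≢-sym)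

module _ {A : Set} where

  Unique⇒lookup-injective : ∀ {xs : List A} → Unique xs → Injective _≡_ _≡_ (lookup xs)
  Unique⇒lookup-injective {_ ∷ _} _ {Fin.zero} {Fin.zero} _ = refl
  Unique⇒lookup-injective (x∉ ∷ _) {Fin.zero} {Fin.suc j} x≡y
    with () ← All.lookup x∉ (∈-lookup j) x≡y
  Unique⇒lookup-injective (x∉ ∷ _) {Fin.suc i} {Fin.zero} y≡x
    with () ← All.lookup x∉ (∈-lookup i) (≡.sym y≡x)
  Unique⇒lookup-injective (_ ∷ xs!) {Fin.suc i} {Fin.suc j} eq =
    cong Fin.suc (Unique⇒lookup-injective xs! eq)

  Linked⇒lookup : ∀ {R : A → A → Set} {xs : List A} → Linked R xs →
    ∀ (i j : Fin (length xs)) → toℕ j ≡ suc (toℕ i) → R (lookup xs i) (lookup xs j)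
  Linked⇒lookup (r ∷ _) Fin.zero (Fin.suc Fin.zero) _ = r
  Linked⇒lookup (_ ∷ rs) (Fin.suc i) (Fin.suc j) eq = Linked⇒lookup rs i j (ℕ.suc-injective eq)
  Linked⇒lookup [-] Fin.zero Fin.zero ()
  Linked⇒lookup (_ ∷ _) Fin.zero (Fin.suc (Fin.suc _)) ()
  Linked⇒lookup (_ ∷ _) (Fin.suc _) Fin.zero ()

  last-lookup : ∀ (xs : List A) (i : Fin (length xs)) → toℕ i ≡ length xs ∸ 1 →
    last xs ≡ just (lookup xs i)
  last-lookup (_ ∷ []) Fin.zero _ = refl
  last-lookup (_ ∷ xs@(_ ∷ _)) (Fin.suc i) eq = last-lookup xs i (ℕ.suc-injective eq)

  last-++ : ∀ (xs : List A) {y ys} → last (xs ++ y ∷ ys) ≡ last (y ∷ ys)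
  last-++ [] = refl
  last-++ (_ ∷ []) = refl
  last-++ (_ ∷ xs@(_ ∷ _)) = last-++ xs

private
  variable
    n : ℕ

elements : Subset n → List (Fin n)
elements [] = []
elements (outside ∷ p) = map Fin.suc (elements p)
elements (inside ∷ p) = Fin.zero ∷ map Fin.suc (elements p)

length-elements : ∀ (p : Subset n) → length (elements p) ≡ ∣ p ∣
length-elements [] = refl
length-elements (outside ∷ p) = ≡.trans (length-map Fin.suc (elements p)) (length-elements p)
length-elements (inside ∷ p) = cong suc (≡.trans (length-map Fin.suc (elements p)) (length-elements p))

elements-⊆ : ∀ (p : Subset n) → All (_∈ p) (elements p)
elements-⊆ [] = []
elements-⊆ (outside ∷ p) = All.map⁺ (All.map there (elements-⊆ p))
elements-⊆ (inside ∷ p) = here ∷ All.map⁺ (All.map there (elements-⊆ p))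

elements-unique : ∀ (p : Subset n) → Unique (elements p)
elements-unique [] = []
elements-unique (outside ∷ p) = Unique.map⁺ Fin.suc-injective (elements-unique p)
elements-unique (inside ∷ p) =
  All.map⁺ (All.universal (λ _ ()) (elements p)) ∷ Unique.map⁺ Fin.suc-injective (elements-unique p)

without : Fin n → List (Fin n) → List (Fin n)
without a = filter (λ x → ¬? (x ≟ a))

without-≢ : ∀ (a : Fin n) xs → All (_≢ a) (without a xs)
without-≢ a = All.all-filter (λ x → ¬? (x ≟ a))

length-without : ∀ (a : Fin n) {xs} → Unique xs → length xs ≤ suc (length (without a xs))
length-without a {[]} _ = z≤n
length-without a {x ∷ xs} (x∉xs ∷ xs!) with x ≟ a
... | yes refl = s≤s (≤-reflexive (≡.sym (cong length (filter-all _ (All.map ≢-sym x∉xs)))))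
... | no _ = s≤s (length-without a xs!)

inner-vertices : ∀ (S : Subset n) {a z : Fin n} → a ≢ z → ∀ m → 2 + m ≤ ∣ S ∣ →
  ∃[ I ] (length I ≡ m × All (_∈ S) I × Unique (a ∷ I ++ [ z ]))
inner-vertices {n} S {a} {z} a≢z m 2+m≤∣S∣ = I , length-I , I⊆S , I-unique
  where
  candidates : List (Fin n)
  candidates = without z (without a (elements S))

  candidates-unique : Unique candidates
  candidates-unique = Unique.filter⁺ _ (Unique.filter⁺ _ (elements-unique S))

  m≤length : m ≤ length candidates
  m≤length = s≤s⁻¹ (s≤s⁻¹ (begin
    2 + m                               ≤⟨ 2+m≤∣S∣ ⟩
    ∣ S ∣                               ≡⟨ length-elements S ⟨
    length (elements S)                 ≤⟨ length-without a (elements-unique S) ⟩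
    1 + length (without a (elements S)) ≤⟨ s≤s (length-without z (Unique.filter⁺ _ (elements-unique S))) ⟩
    2 + length candidates               ∎))
    where open ℕ.≤-Reasoning

  I : List (Fin n)
  I = take m candidates

  length-I : length I ≡ m
  length-I = ≡.trans (length-take m candidates) (m≤n⇒m⊓n≡m m≤length)

  I⊆S : All (_∈ S) I
  I⊆S = All.take⁺ m (All.filter⁺ _ (All.filter⁺ _ (elements-⊆ S)))

  I≢a : All (_≢ a) I
  I≢a = All.take⁺ m (All.filter⁺ _ (without-≢ a (elements S)))

  I≢z : All (_≢ z) I
  I≢z = All.take⁺ m (without-≢ z (without a (elements S)))

  I-unique : Unique (a ∷ I ++ [ z ])
  I-unique = All.++⁺ (All.map ≢-sym I≢a) (a≢z ∷ [])
           ∷ Unique.++⁺ (Unique.take⁺ m candidates-unique) ([] ∷ []) λ where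
               (v∈I , here refl) → All.lookup I≢z v∈I refl

Empty-∩⇒Disjoint : ∀ {p q : Subset n} {xs ys} →
  Empty (p ∩ q) → All (_∈ p) xs → All (_∈ q) ys → Disjoint xs ys
Empty-∩⇒Disjoint p∩q≡∅ xs⊆p ys⊆q (v∈xs , v∈ys) =
  p∩q≡∅ (_ , x∈p∩q⁺ (All.lookup xs⊆p v∈xs , All.lookup ys⊆q v∈ys))

record Path (G : Graph n) (a z : Fin n) (k : ℕ) : Set where
  field
    vertices : List (Fin n)
    length≡  : length vertices ≡ k
    head≡    : head vertices ≡ just a
    last≡    : last vertices ≡ just z
    linked   : Linked (Adj G) vertices
    unique   : Unique vertices

open Path

module _ {G : Graph n} where

  join : ∀ {a b c d k l} (P : Path G a b k) → Adj G b c → (Q : Path G c d l) →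
    Disjoint (vertices P) (vertices Q) → Path G a d (k + l)
  join P@record { vertices = _ ∷ _ } b~c Q@record { vertices = _ ∷ _ } P∩Q≡∅ = record
    { vertices = vertices P ++ vertices Q
    ; length≡  = ≡.trans (length-++ (vertices P)) (≡.cong₂ _+_ (length≡ P) (length≡ Q))
    ; head≡    = head≡ P
    ; last≡    = ≡.trans (last-++ (vertices P)) (last≡ Q)
    ; linked   = Linked.++⁺ (linked P) P~Q (linked Q)
    ; unique   = Unique.++⁺ (unique P) (unique Q) P∩Q≡∅
    }
    where
    P~Q : Connected (Adj G) (last (vertices P)) (head (vertices Q))
    P~Q = subst₂ (Connected (Adj G)) (≡.sym (last≡ P)) (≡.sym (head≡ Q)) (just b~c)

  path⇒cycle : ∀ {a z k} → Path G a z k → Adj G z a → 3 ≤ k → Cycle G k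
  path⇒cycle {z = z} P@record { vertices = xs@(_ ∷ _) ; length≡ = refl ; head≡ = refl } z~a 3≤k =
    record
      { length≥3 = 3≤k
      ; vertex   = lookup xs
      ; distinct = Unique⇒lookup-injective (unique P)
      ; step     = Linked⇒lookup (linked P)
      ; close    = close
      }
    where
    close : ∀ i j → toℕ i ≡ length xs ∸ 1 → toℕ j ≡ 0 → Adj G (lookup xs i) (lookup xs j)
    close i Fin.zero i-last refl = subst (λ v → Adj G v (lookup xs Fin.zero)) z≡xsᵢ z~a
      where
      z≡xsᵢ : z ≡ lookup xs i
      z≡xsᵢ = just-injective (≡.trans (≡.sym (last≡ P)) (last-lookup xs i i-last))

module _ {G : Graph n} {R S : Subset n} (H : Hedgehog G R S) where
  open Hedgehog H

  hedgehog-adj : ∀ {w x} → w ∈ R → x ∈ S → w ≢ x → Adj G w x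
  hedgehog-adj {w} {x} w∈R x∈S w≢x with w ∈? S
  ... | yes w∈S = clique w x w∈S x∈S w≢x
  ... | no w∉S = spikes w x w∈R w∉S x∈S

  hedgehog-linked : ∀ {w x z I} → w ∈ R → x ∈ S → All (_∈ S) I → z ∈ R →
    Unique (w ∷ x ∷ I ++ [ z ]) → Linked (Adj G) (w ∷ x ∷ I ++ [ z ])
  hedgehog-linked w∈R x∈S [] z∈R ((w≢x ∷ _) ∷ (x≢z ∷ []) ∷ _) =
    hedgehog-adj w∈R x∈S w≢x ∷ sym G (hedgehog-adj z∈R x∈S (≢-sym x≢z)) ∷ [-]
  hedgehog-linked w∈R x∈S (y∈S ∷ I⊆S) z∈R ((w≢x ∷ _) ∷ x∷I!) =
    hedgehog-adj w∈R x∈S w≢x ∷ hedgehog-linked (X⊆W x∈S) y∈S I⊆S z∈R x∷I!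

  hedgehog-path : ∀ {a z k} → a ∈ R → z ∈ R → a ≢ z → 3 ≤ k → k ≤ ∣ S ∣ →
    Σ (Path G a z k) (λ P → All (_∈ R) (vertices P))
  hedgehog-path {a} {z} a∈R z∈R a≢z (s≤s (s≤s (s≤s {n = m} _))) k≤∣S∣
    with inner-vertices S a≢z (suc m) k≤∣S∣
  ... | x ∷ I , length-x∷I , x∈S ∷ I⊆S , unique =
    P , a∈R ∷ All.++⁺ (All.map X⊆W (x∈S ∷ I⊆S)) (z∈R ∷ [])
    where
    P : Path G a z (3 + m)
    P = record
      { vertices = a ∷ x ∷ I ++ [ z ]
      ; length≡  = cong (suc ∘ suc) (≡.trans (≡.trans (length-++ I) (+-comm (length I) 1)) length-x∷I)
      ; head≡    = refl
      ; last≡    = last-++ (a ∷ x ∷ I)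
      ; linked   = hedgehog-linked a∈R x∈S I⊆S z∈R unique
      ; unique   = unique
      }

split-between : ∀ {a b s t k} → a ≤ s → b ≤ t → a + b ≤ k → k ≤ s + t →
  ∃[ i ] ∃[ j ] (a ≤ i × i ≤ s × b ≤ j × j ≤ t × i + j ≡ k)
-- Take i = s when that still leaves j ≥ b, and otherwise j = b.
split-between {a} {b} {s} {t} {k} a≤s b≤t a+b≤k k≤s+t with s + b ≤? k
... | yes s+b≤k = s , k ∸ s , a≤s , ≤-reflexive refl ,
      m+n≤o⇒m≤o∸n b (≤-trans (≤-reflexive (+-comm b s)) s+b≤k) , m≤n+o⇒m∸n≤o k s k≤s+t ,
      m+[n∸m]≡n (≤-trans (m≤m+n s b) s+b≤k)
... | no s+b≰k = k ∸ b , b , m+n≤o⇒m≤o∸n a a+b≤k ,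
      m≤n+o⇒m∸n≤o k b (≤-trans (<⇒≤ (≰⇒> s+b≰k)) (≤-reflexive (+-comm s b))) ,
      ≤-reflexive refl , b≤t , m∸n+n≡m (≤-trans (m≤n+m b a) a+b≤k)

corollary6 : (n : ℕ) (G : Graph n) (R₁ S₁ R₂ S₂ : Subset n)
    → Hedgehog G R₁ S₁ → Hedgehog G R₂ S₂
    → Empty (R₁ ∩ R₂)
    → 3 ≤ ∣ S₁ ∣ → 3 ≤ ∣ S₂ ∣
    → TwoDisjointCrossingEdges G R₁ R₂
    → (k : ℕ) → 6 ≤ k → k ≤ ∣ S₁ ∣ + ∣ S₂ ∣ → Cycle G k
corollary6 n G R₁ S₁ R₂ S₂ H₁ H₂ R₁∩R₂≡∅ 3≤∣S₁∣ 3≤∣S₂∣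
  -- a₁ ≢ b₂ and b₁ ≢ a₂ already follow from R₁ ∩ R₂ = ∅.
  (a₁ , b₁ , a₂ , b₂ , a₁∈R₁ , b₁∈R₂ , a₂∈R₁ , b₂∈R₂ , a₁~b₁ , a₂~b₂ , a₁≢a₂ , _ , _ , b₁≢b₂)
  k 6≤k k≤
  with split-between 3≤∣S₁∣ 3≤∣S₂∣ 6≤k k≤
... | k₁ , k₂ , 3≤k₁ , k₁≤∣S₁∣ , 3≤k₂ , k₂≤∣S₂∣ , refl
  with P₁ , P₁⊆R₁ ← hedgehog-path H₁ a₁∈R₁ a₂∈R₁ a₁≢a₂ 3≤k₁ k₁≤∣S₁∣
     | P₂ , P₂⊆R₂ ← hedgehog-path H₂ b₂∈R₂ b₁∈R₂ (≢-sym b₁≢b₂) 3≤k₂ k₂≤∣S₂∣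
  = path⇒cycle (join P₁ a₂~b₂ P₂ (Empty-∩⇒Disjoint R₁∩R₂≡∅ P₁⊆R₁ P₂⊆R₂))
               (sym G a₁~b₁) (≤-trans 3≤k₁ (m≤m+n k₁ k₂))
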